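{- There is an infinite family of graphs $\mathcal{G}$ such that a graph $G \in \mathcal{G}$ with $n$ vertices has clique-partitioned treewidth in $\mathcal{O}(\log\log n)$ and BBKMZ-treewidth in $\Omega(\log n)$.
   Context: Graphs are simple and undirected. A tree decomposition of $G=(V,E)$ is a pair $(T,B)$ of a tree $T$ and a map $B$ assigning to each node of $T$ a subset of $V$ (a bag) such that every vertex lies in some bag, every edge has both endpoints in some bag, and for every vertex the bags containing it form a connected subtree of $T$. A clique-partitioned tree decomposition of $G$ is a tree decomposition together with, for every node $t$ of $T$, a partition $\mathcal{P}_t$ of the induced subgraph $G[B(t)]$ into cliques. The weight of a clique $C$ is $\log_2(|C|+1)$, the weight of a bag is the sum of the weights of the cliques in its partition, and the weight of the decomposition is the maximum weight of any bag. The clique-partitioned treewidth of $G$ is the minimum weight of any clique-partitioned tree decomposition of $G$. For a clique partition $\mathcal{P}$ of the whole graph $G$, a $\mathcal{P}$-flattened tree decomposition is a clique-partitioned tree decomposition of $G$ in which the partition into cliques within each bag is induced by the global partition $\mathcal{P}$; its weight is the maximum total weight of the cliques in any of its bags. The BBKMZ-treewidth of $G$ is the minimum weight of a $\mathcal{P}$-flattened tree decomposition over all clique partitions $\mathcal{P}$ of $G$. -}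

module Defs where

open import Data.Nat using (ℕ; zero; suc; _+_; _*_; _^_; _≤_; _<_)
open import Data.Nat.Logarithm using (⌊log₂_⌋)
open import Data.Fin using (Fin; zero; suc; toℕ)
open import Data.Bool using (Bool; true; false; if_then_else_)
open import Data.Product using (Σ; ∃; _×_; _,_)
open import Data.Sum using (_⊎_)
open import Relation.Binary.PropositionalEquality using (_≡_; _≢_)
open import Relation.Nullary using (¬_; does)
open import Data.Fin.Properties using (_≟_)

countB : ∀ {n} → (Fin n → Bool) → ℕ
countB {zero} f = 0
countB {suc n} f = (if f zero then 1 else 0) + countB (λ i → f (suc i))

prodF : ∀ {n} → (Fin n → ℕ) → ℕ
prodF {zero} f = 1
prodF {suc n} f = f zero * prodF (λ i → f (suc i))

record Graph (n : ℕ) : Set where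
  field
    adj   : Fin n → Fin n → Bool
    sym   : ∀ u v → adj u v ≡ adj v u
    irrefl : ∀ v → adj v v ≡ false
open Graph public

-- A tree on node set Fin (suc k), given by parent pointers:
-- node (suc j) has parent (par j) with toℕ (par j) ≤ toℕ j.
-- Every finite tree is isomorphic to one of this form.
record Tree : Set where
  field
    k     : ℕ
    par   : Fin k → Fin (suc k)
    par<  : ∀ j → toℕ (par j) ≤ toℕ j
open Tree public

Node : Tree → Set
Node T = Fin (suc (k T))

data TEdge (T : Tree) : Node T → Node T → Set where
  up   : ∀ j → TEdge T (suc j) (par T j)
  down : ∀ j → TEdge T (par T j) (suc j)

data WalkIn (T : Tree) (S : Node T → Bool) : Node T → Node T → Set where
  here : ∀ {t} → S t ≡ true → WalkIn T S t t
  step : ∀ {t t' t''} → S t ≡ true → TEdge T t t' → WalkIn T S t' t'' → WalkIn T S t t''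

ConnectedIn : (T : Tree) → (Node T → Bool) → Set
ConnectedIn T S = ∀ t t' → S t ≡ true → S t' ≡ true → WalkIn T S t t'

record TreeDec {n : ℕ} (G : Graph n) : Set where
  field
    tree   : Tree
    bag    : Node tree → Fin n → Bool
    cover  : ∀ v → ∃ λ t → bag t v ≡ true
    edges  : ∀ u v → adj G u v ≡ true → ∃ λ t → (bag t u ≡ true × bag t v ≡ true)
    conn   : ∀ v → ConnectedIn tree (λ t → bag t v)
open TreeDec public

-- A partition of a vertex set S into classes is given by a labelling
-- lab : Fin n → Fin n; the class with label c is {v ∈ S | lab v ≡ c}.
CliqueLabelling : ∀ {n} → Graph n → (Fin n → Bool) → (Fin n → Fin n) → Set
CliqueLabelling G S lab = ∀ u v → S u ≡ true → S v ≡ true → lab u ≡ lab v → u ≢ v → adj G u v ≡ true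

classSize : ∀ {n} → (Fin n → Bool) → (Fin n → Fin n) → Fin n → ℕ
classSize S lab c = countB (λ v → if S v then does (lab v ≟ c) else false)

-- 2 ^ (weight of the bag S with clique partition given by lab):
-- weight = Σ_C log₂(|C|+1) = log₂ Π_C (|C|+1); empty classes contribute factor 1.
expWeight : ∀ {n} → (Fin n → Bool) → (Fin n → Fin n) → ℕ
expWeight S lab = prodF (λ c → suc (classSize S lab c))

record CPTreeDec {n : ℕ} (G : Graph n) : Set where
  field
    dec   : TreeDec G
    lab   : Node (tree dec) → Fin n → Fin n
    cliq  : ∀ t → CliqueLabelling G (bag dec t) (lab t)
open CPTreeDec public

-- clique-partitioned treewidth of G ≤ log₂ w
--   iff some decomposition has all bag weights ≤ log₂ w
CPTWExpAtMost : ∀ {n} → Graph n → ℕ → Set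
CPTWExpAtMost G w = Σ (CPTreeDec G) λ D → ∀ t → expWeight (bag (dec D) t) (lab D t) ≤ w

GlobalCliquePartition : ∀ {n} → Graph n → (Fin n → Fin n) → Set
GlobalCliquePartition G P = CliqueLabelling G (λ _ → true) P

-- BBKMZ-treewidth of G ≥ (1/d) log₂ m
--   iff for every clique partition P of G and every P-flattened tree
--   decomposition some bag B has weight ≥ (1/d) log₂ m,
--   i.e. (2^weight(B))^d ≥ m.
BBKMZAtLeast : ∀ {n} → Graph n → ℕ → ℕ → Set
BBKMZAtLeast {n} G d m = (P : Fin n → Fin n) → GlobalCliquePartition G P →
  (D : TreeDec G) → ∃ λ t → m ≤ expWeight (bag D t) P ^ d

-- The family is the comparability graphs of complete binary trees (u ~ v iff one is an
-- ancestor of the other) on n = 2^(i+2) vertices. Decomposing along the tree itself,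
-- with the bag at t the root path of t taken as a single clique, gives bags of weight
-- log₂(depth + 2) = O(log log n). Conversely, a clique of a comparability graph is a
-- chain, so a clique partition P can meet at most one of the two subtrees below any
-- node x in the class of x; descending into the other subtree from the root builds a
-- root-to-leaf path whose log₂ n vertices lie in pairwise distinct classes of P. This
-- path is a clique, hence contained in a single bag of any tree decomposition, and
-- each class it meets adds weight at least log₂ 2 = 1 to that bag.
module Submission where

open import Defs
open import Data.Bool using (Bool; true; false; if_then_else_; _∧_; not)
open import Data.Empty using (⊥)
open import Data.Fin using (Fin; zero; suc; toℕ; fromℕ<)
open import Data.Fin.Properties using (_≟_; any?; toℕ-injective; toℕ-fromℕ<; toℕ<n; suc-injective)
open import Data.List using (List; []; _∷_; length)
open import Data.List.Extrema.Nat using (argmax; argmax-all; f[⊥]≤f[argmax]; f[xs]≤f[argmax])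
open import Data.List.Membership.Propositional using (_∈_)
open import Data.List.Relation.Unary.All as All using (All; []; _∷_)
open import Data.List.Relation.Unary.AllPairs as AllPairs using (AllPairs; []; _∷_)
open import Data.List.Relation.Unary.Any using (here; there)
open import Data.Nat using (ℕ; zero; suc; _+_; _*_; _^_; _≤_; _<_; z≤n; s≤s; s≤s⁻¹; ⌊_/2⌋; ⌈_/2⌉)
open import Data.Nat.Logarithm using (⌊log₂_⌋; ⌊log₂[2^n]⌋≡n)
open import Data.Nat.Properties
  using ( ≤-refl; ≤-reflexive; ≤-trans; ≤-<-trans; <⇒≤; <⇒≱; ≤∧≢⇒<; 1+n≰n; n≤0⇒n≡0; n≤1+n
        ; m≤n⇒m≤1+n; m≤m+n; m≤n+m; m≤m*n; +-mono-≤; +-monoʳ-≤; *-mono-≤; *-monoʳ-≤; *-cancelˡ-<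
        ; *-identityʳ; *-assoc; m^n≢0; ^-monoʳ-<; ⌊n/2⌋≤n; ⌊n/2⌋≤⌈n/2⌉; ⌊n/2⌋+⌈n/2⌉≡n
        ; n≡⌊n+n/2⌋; n≡⌈n+n/2⌉; *-commutativeSemigroup; module ≤-Reasoning
        ; *-monoˡ-≤; +-identityʳ; n<1+n )
open import Algebra.Properties.CommutativeSemigroup *-commutativeSemigroup using (x∙yz≈y∙xz)
open import Data.Nat.Tactic.RingSolver using (solve-∀)
open import Data.Product as Product using (Σ; ∃; _×_; _,_; proj₁; proj₂)
open import Data.Sum as Sum using (_⊎_; inj₁; inj₂)
open import Function using (_∘_; mk⇔)
open import Relation.Binary.PropositionalEquality as ≡ using (_≡_; _≢_; refl; cong; subst)
open import Relation.Nullary using (Dec; yes; no; does; ¬_; contradiction)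
open import Relation.Nullary.Decidable using (dec-true; dec-false; does-⇔; map′; ¬?; _×-dec_; _⊎-dec_)

from-does : ∀ {A : Set} (a? : Dec A) → does a? ≡ true → A
from-does (yes a) _  = a
from-does (no _)  ()

leastTrue : ∀ {n} (S : Fin n → Bool) {t} → S t ≡ true →
            Σ (Fin n) λ m → S m ≡ true × (∀ t → S t ≡ true → toℕ m ≤ toℕ t)
leastTrue {suc n} S {t} St with S zero in S0
... | true = zero , S0 , λ _ _ → z≤n
leastTrue {suc n} S {zero}  St | false = contradiction (≡.trans (≡.sym S0) St) λ ()
leastTrue {suc n} S {suc t} St | false with leastTrue (S ∘ suc) St
... | m , Sm , m-least = suc m , Sm , bound
  where
  bound : ∀ t → S t ≡ true → toℕ (suc m) ≤ toℕ t
  bound zero    St′ = contradiction (≡.trans (≡.sym S0) St′) λ ()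
  bound (suc t) St′ = s≤s (m-least t St′)

allPairs-∈ : ∀ {A : Set} {R : A → A → Set} {L u v} →
             AllPairs R L → u ∈ L → v ∈ L → u ≡ v ⊎ R u v ⊎ R v u
allPairs-∈ (_  ∷ _)  (here refl) (here refl) = inj₁ refl
allPairs-∈ (Rx ∷ _)  (here refl) (there v∈) = inj₂ (inj₁ (All.lookup Rx v∈))
allPairs-∈ (Rx ∷ _)  (there u∈) (here refl) = inj₂ (inj₂ (All.lookup Rx u∈))
allPairs-∈ (_  ∷ Rs) (there u∈) (there v∈) = allPairs-∈ Rs u∈ v∈

data Ancestor (T : Tree) : Node T → Node T → Set where
  self   : ∀ {a} → Ancestor T a a
  parent : ∀ {a} j → Ancestor T a (par T j) → Ancestor T a (suc j)

Comparable : (T : Tree) → Node T → Node T → Set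
Comparable T u v = Ancestor T u v ⊎ Ancestor T v u

module _ {T : Tree} where

  ancestor⇒≤ : ∀ {a b} → Ancestor T a b → toℕ a ≤ toℕ b
  ancestor⇒≤ self         = ≤-refl
  ancestor⇒≤ (parent j p) = ≤-trans (ancestor⇒≤ p) (≤-trans (par< T j) (n≤1+n _))

  ancestor-trans : ∀ {a b c} → Ancestor T a b → Ancestor T b c → Ancestor T a c
  ancestor-trans p self         = p
  ancestor-trans p (parent j q) = parent j (ancestor-trans p q)

  parent⇒ancestor : ∀ {j x} → par T j ≡ x → Ancestor T x (suc j)
  parent⇒ancestor {j} refl = parent j self

  ancestors-comparable : ∀ {a b w} → Ancestor T a w → Ancestor T b w → Comparable T a b
  ancestors-comparable self         q             = inj₂ q
  ancestors-comparable (parent j p) self          = inj₁ (parent j p)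
  ancestors-comparable (parent j p) (parent .j q) = ancestors-comparable p q

  ¬ancestor-of-parent : ∀ j → ¬ Ancestor T (suc j) (par T j)
  ¬ancestor-of-parent j p = 1+n≰n (≤-trans (ancestor⇒≤ p) (par< T j))

  ¬ancestor-of-sibling : ∀ {i j} → par T i ≡ par T j → i ≢ j → ¬ Ancestor T (suc i) (suc j)
  ¬ancestor-of-sibling pi≡pj i≢j self          = i≢j refl
  ¬ancestor-of-sibling pi≡pj i≢j (parent j p) =
    ¬ancestor-of-parent _ (subst (Ancestor T _) (≡.sym pi≡pj) p)

  siblings-disjoint : ∀ {i j w} → par T i ≡ par T j → i ≢ j →
                      Ancestor T (suc i) w → Ancestor T (suc j) w → ⊥
  siblings-disjoint pi≡pj i≢j p q with ancestors-comparable p q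
  ... | inj₁ i≼j = ¬ancestor-of-sibling pi≡pj i≢j i≼j
  ... | inj₂ j≼i = ¬ancestor-of-sibling (≡.sym pi≡pj) (i≢j ∘ ≡.sym) j≼i

  ancestor? : ∀ a b → Dec (Ancestor T a b)
  ancestor? a b = search (suc (toℕ b)) b ≤-refl
    where
    search : ∀ fuel b → toℕ b < fuel → Dec (Ancestor T a b)
    search (suc fuel) b b<fuel with a ≟ b
    ... | yes refl = yes self
    search (suc fuel) zero    _              | no a≢b = no λ { self → a≢b refl }
    search (suc fuel) (suc j) (s≤s j<fuel) | no a≢b =
      map′ (parent j) (λ { self → contradiction refl a≢b ; (parent _ p) → p })
           (search fuel (par T j) (≤-<-trans (par< T j) j<fuel))

  distinct-comparable? : ∀ u v → Dec (u ≢ v × Comparable T u v)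
  distinct-comparable? u v = ¬? (u ≟ v) ×-dec (ancestor? u v ⊎-dec ancestor? v u)

module _ {T : Tree} where

  _++ʷ_ : ∀ {S a b c} → WalkIn T S a b → WalkIn T S b c → WalkIn T S a c
  here _     ++ʷ w′ = w′
  step s e w ++ʷ w′ = step s e (w ++ʷ w′)

  walk-start : ∀ {S t t′} → WalkIn T S t t′ → S t ≡ true
  walk-start (here s)     = s
  walk-start (step s _ _) = s

  walk-exits-via-parent : ∀ {S u y} j → WalkIn T S u y → Ancestor T (suc j) u →
                          Ancestor T (suc j) y ⊎ S (par T j) ≡ true
  walk-exits-via-parent j (here _)              j≼u            = inj₁ j≼u
  walk-exits-via-parent j (step _ (up _) w)     self           = inj₂ (walk-start w)
  walk-exits-via-parent j (step _ (up i) w)     (parent .i j≼u) = walk-exits-via-parent j w j≼u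
  walk-exits-via-parent j (step _ (down i) w)   j≼u            = walk-exits-via-parent j w (parent i j≼u)

  connected-∋-parent : ∀ {S j m} → ConnectedIn T S → S (suc j) ≡ true → S m ≡ true →
                       toℕ m < toℕ (suc j) → S (par T j) ≡ true
  connected-∋-parent {j = j} S-conn Sj Sm m<j with walk-exits-via-parent j (S-conn _ _ Sj Sm) self
  ... | inj₁ j≼m  = contradiction (ancestor⇒≤ j≼m) (<⇒≱ m<j)
  ... | inj₂ Spar = Spar

  connected-∋-ancestor : ∀ {S m a w} → ConnectedIn T S → S m ≡ true → S w ≡ true →
                         Ancestor T a w → toℕ m ≤ toℕ a → S a ≡ true
  connected-∋-ancestor S-conn Sm Sw self         m≤a = Sw
  connected-∋-ancestor S-conn Sm Sw (parent j p) m≤a =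
    connected-∋-ancestor S-conn Sm (connected-∋-parent S-conn Sw Sm m<j) p m≤a
    where m<j = s≤s (≤-trans m≤a (≤-trans (ancestor⇒≤ p) (par< T j)))

  least-is-ancestor : ∀ {S m} → ConnectedIn T S → S m ≡ true →
                      (∀ t → S t ≡ true → toℕ m ≤ toℕ t) →
                      ∀ {w} → S w ≡ true → Ancestor T m w
  least-is-ancestor {S} {m} S-conn Sm m-least {w} = climb (suc (toℕ w)) w ≤-refl
    where
    climb : ∀ fuel w → toℕ w < fuel → S w ≡ true → Ancestor T m w
    climb (suc fuel) zero _ Sw =
      subst (λ x → Ancestor T x zero) (≡.sym (toℕ-injective (n≤0⇒n≡0 (m-least zero Sw)))) self
    climb (suc fuel) (suc j) (s≤s j<fuel) Sw with m ≟ suc j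
    ... | yes refl = self
    ... | no m≢w   = parent j (climb fuel (par T j) (≤-<-trans (par< T j) j<fuel) Spar)
      where Spar = connected-∋-parent S-conn Sw Sm (≤∧≢⇒< (m-least _ Sw) (m≢w ∘ toℕ-injective))

module _ {n} {G : Graph n} (D : TreeDec G) where

  private
    root : Fin n → Node (tree D)
    root v = proj₁ (leastTrue (λ t → bag D t v) (proj₂ (cover D v)))

    root∈ : ∀ v → bag D (root v) v ≡ true
    root∈ v = proj₁ (proj₂ (leastTrue (λ t → bag D t v) (proj₂ (cover D v))))

    root-least : ∀ v t → bag D t v ≡ true → toℕ (root v) ≤ toℕ t
    root-least v = proj₂ (proj₂ (leastTrue (λ t → bag D t v) (proj₂ (cover D v))))

  -- Helly property of subtrees: the deepest of the subtree roots lies in every subtree.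
  common-bag : ∀ x xs →
               (∀ {u v} → u ∈ x ∷ xs → v ∈ x ∷ xs → ∃ λ t → bag D t u ≡ true × bag D t v ≡ true) →
               ∃ λ t → All (λ v → bag D t v ≡ true) (x ∷ xs)
  common-bag x xs meet = root deepest , All.tabulate deepest-root-∈
    where
    deepest : Fin n
    deepest = argmax (toℕ ∘ root) x xs

    deepest∈ : deepest ∈ x ∷ xs
    deepest∈ = argmax-all (toℕ ∘ root) {P = _∈ x ∷ xs} (here refl) (All.tabulate there)

    deepest-max : All (λ v → toℕ (root v) ≤ toℕ (root deepest)) (x ∷ xs)
    deepest-max = f[⊥]≤f[argmax] {f = toℕ ∘ root} x xs ∷ f[xs]≤f[argmax] {f = toℕ ∘ root} x xs

    deepest-root-∈ : ∀ {u} → u ∈ x ∷ xs → bag D (root deepest) u ≡ true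
    deepest-root-∈ {u} u∈ with meet u∈ deepest∈
    ... | w , u∈w , deepest∈w =
      connected-∋-ancestor (conn D u) (root∈ u) u∈w
        (least-is-ancestor (conn D deepest) (root∈ deepest) (root-least deepest) deepest∈w)
        (All.lookup deepest-max u∈)

  clique⊆bag : ∀ x xs → AllPairs (λ u v → adj G u v ≡ true) (x ∷ xs) →
               ∃ λ t → All (λ v → bag D t v ≡ true) (x ∷ xs)
  clique⊆bag x xs clique = common-bag x xs meet
    where
    meet : ∀ {u v} → u ∈ x ∷ xs → v ∈ x ∷ xs → ∃ λ t → bag D t u ≡ true × bag D t v ≡ true
    meet {u} u∈ v∈ with allPairs-∈ clique u∈ v∈
    ... | inj₁ refl      = proj₁ (cover D u) , proj₂ (cover D u) , proj₂ (cover D u)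
    ... | inj₂ (inj₁ uv) = edges D _ _ uv
    ... | inj₂ (inj₂ vu) = Product.map₂ Product.swap (edges D _ _ vu)

countB-mono : ∀ {n} {f g : Fin n → Bool} → (∀ v → f v ≡ true → g v ≡ true) → countB f ≤ countB g
countB-mono {zero}          f⊆g = z≤n
countB-mono {suc n} {f} {g} f⊆g with f zero in f0 | g zero in g0
... | true  | true  = s≤s (countB-mono (f⊆g ∘ suc))
... | true  | false = contradiction (≡.trans (≡.sym g0) (f⊆g zero f0)) λ ()
... | false | true  = m≤n⇒m≤1+n (countB-mono (f⊆g ∘ suc))
... | false | false = countB-mono (f⊆g ∘ suc)

countB-none : ∀ {n} {f : Fin n → Bool} → (∀ v → f v ≡ false) → countB f ≡ 0
countB-none {zero}      _      = refl
countB-none {suc n} {f} f-none rewrite f-none zero = countB-none (f-none ∘ suc)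

countB-some : ∀ {n} {f : Fin n → Bool} v → f v ≡ true → 1 ≤ countB f
countB-some {suc n} {f} zero    fv rewrite fv = s≤s z≤n
countB-some {suc n} {f} (suc v) fv with f zero
... | true  = s≤s z≤n
... | false = countB-some v fv

countB-tail≤ : ∀ {n} (f : Fin (suc n) → Bool) → countB (f ∘ suc) ≤ countB f
countB-tail≤ f = m≤n+m _ _

countB-≤-suc : ∀ {n} {f g : Fin n → Bool} x → (∀ v → f v ≡ true → g v ≡ true ⊎ v ≡ x) →
               countB f ≤ suc (countB g)
countB-≤-suc {suc n} {f} {g} zero f⊆g∪x =
  ≤-trans (+-mono-≤ (indicator≤1 (f zero)) (countB-mono below)) (s≤s (countB-tail≤ g))
  where
  indicator≤1 : ∀ b → (if b then 1 else 0) ≤ 1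
  indicator≤1 true  = ≤-refl
  indicator≤1 false = z≤n
  below : ∀ v → f (suc v) ≡ true → g (suc v) ≡ true
  below v fv with f⊆g∪x (suc v) fv
  ... | inj₁ gv = gv
countB-≤-suc {suc n} {f} {g} (suc x) f⊆g∪x with f zero in f0
... | true with f⊆g∪x zero f0
...   | inj₁ g0 rewrite g0 = s≤s (countB-≤-suc x (λ v → Sum.map₂ suc-injective ∘ f⊆g∪x (suc v)))
countB-≤-suc {suc n} {f} {g} (suc x) f⊆g∪x | false =
  ≤-trans (countB-≤-suc x (λ v → Sum.map₂ suc-injective ∘ f⊆g∪x (suc v))) (s≤s (countB-tail≤ g))

prodF-mono : ∀ {n} {f g : Fin n → ℕ} → (∀ c → f c ≤ g c) → prodF f ≤ prodF g
prodF-mono {zero}  f≤g = ≤-refl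
prodF-mono {suc n} f≤g = *-mono-≤ (f≤g zero) (prodF-mono (f≤g ∘ suc))

prodF-≥1 : ∀ {n} {f : Fin n → ℕ} → (∀ c → 1 ≤ f c) → 1 ≤ prodF f
prodF-≥1 {zero}  f≥1 = ≤-refl
prodF-≥1 {suc n} f≥1 = *-mono-≤ (f≥1 zero) (prodF-≥1 (f≥1 ∘ suc))

prodF-≤1 : ∀ {n} {f : Fin n → ℕ} → (∀ c → f c ≤ 1) → prodF f ≤ 1
prodF-≤1 {zero}  f≤1 = ≤-refl
prodF-≤1 {suc n} f≤1 = *-mono-≤ (f≤1 zero) (prodF-≤1 (f≤1 ∘ suc))

prodF-scale : ∀ {n} a {f g : Fin n → ℕ} c → (∀ c → f c ≤ g c) → a * f c ≤ g c →
              a * prodF f ≤ prodF g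
prodF-scale {suc n} a {f} {g} zero f≤g afc≤gc = begin
  a * (f zero * prodF (f ∘ suc)) ≡⟨ *-assoc a _ _ ⟨
  a * f zero * prodF (f ∘ suc)   ≤⟨ *-mono-≤ afc≤gc (prodF-mono (f≤g ∘ suc)) ⟩
  g zero * prodF (g ∘ suc)       ∎
  where open ≤-Reasoning
prodF-scale {suc n} a {f} {g} (suc c) f≤g afc≤gc = begin
  a * (f zero * prodF (f ∘ suc)) ≡⟨ x∙yz≈y∙xz a (f zero) _ ⟩
  f zero * (a * prodF (f ∘ suc)) ≤⟨ *-mono-≤ (f≤g zero) (prodF-scale a c (f≤g ∘ suc) afc≤gc) ⟩
  g zero * prodF (g ∘ suc)       ∎
  where open ≤-Reasoning

module _ {n : ℕ} where

  dropClass : (Fin n → Bool) → (Fin n → Fin n) → Fin n → Fin n → Bool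
  dropClass S P c u = S u ∧ not (does (P u ≟ c))

  dropClass-keeps : ∀ {S P c u} → S u ≡ true → P u ≢ c → dropClass S P c u ≡ true
  dropClass-keeps {S} {P} {c} {u} Su Pu≢c rewrite Su | dec-false (P u ≟ c) Pu≢c = refl

  classSize-dropClass : ∀ S P c c′ → classSize (dropClass S P c) P c′ ≤ classSize S P c′
  classSize-dropClass S P c c′ = countB-mono kept
    where
    kept : ∀ u → (if dropClass S P c u then does (P u ≟ c′) else false) ≡ true →
                 (if S u then does (P u ≟ c′) else false) ≡ true
    kept u e with S u | P u ≟ c
    ... | true | no _ = e

  classSize-dropped : ∀ S P c → classSize (dropClass S P c) P c ≡ 0
  classSize-dropped S P c = countB-none dropped
    where
    dropped : ∀ u → (if dropClass S P c u then does (P u ≟ c) else false) ≡ false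
    dropped u with S u | P u ≟ c
    ... | false | _     = refl
    ... | true  | yes _ = refl
    ... | true  | no _  = refl

  classSize-own : ∀ {S} P {v} → S v ≡ true → 1 ≤ classSize S P (P v)
  classSize-own {S} P {v} Sv =
    countB-some {f = λ (u : Fin n) → if S u then does (P u ≟ P v) else false} v own
    where
    own : (if S v then does (P v ≟ P v) else false) ≡ true
    own rewrite Sv = dec-true (P v ≟ P v) refl

  expWeight-dropClass : ∀ {S} P {v} → S v ≡ true →
                        2 * expWeight (dropClass S P (P v)) P ≤ expWeight S P
  expWeight-dropClass {S} P {v} Sv =
    prodF-scale 2 (P v) (λ c → s≤s (classSize-dropClass S P (P v) c)) doubled
    where
    doubled : 2 * suc (classSize (dropClass S P (P v)) P (P v)) ≤ suc (classSize S P (P v))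
    doubled rewrite classSize-dropped S P (P v) = s≤s (classSize-own {S} P {v} Sv)

  2^length≤expWeight : ∀ S P L → All (λ v → S v ≡ true) L → AllPairs (λ u v → P u ≢ P v) L →
                       2 ^ length L ≤ expWeight S P
  2^length≤expWeight S P []      []        []                =
    prodF-≥1 {f = λ c → suc (classSize S P c)} (λ _ → s≤s z≤n)
  2^length≤expWeight S P (v ∷ L) (Sv ∷ SL) (v≢L ∷ distinct) = begin
    2 * 2 ^ length L                      ≤⟨ *-monoʳ-≤ 2 (2^length≤expWeight _ P L kept distinct) ⟩
    2 * expWeight (dropClass S P (P v)) P ≤⟨ expWeight-dropClass {S} P Sv ⟩
    expWeight S P                         ∎
    where
    open ≤-Reasoning
    kept : All (λ u → dropClass S P (P v) u ≡ true) L
    kept = All.zipWith (λ (Su , Pv≢Pu) → dropClass-keeps {S} {P} Su (Pv≢Pu ∘ ≡.sym)) (SL , v≢L)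

expWeight-oneClass : ∀ {n} (S : Fin (suc n) → Bool) → expWeight S (λ _ → zero) ≤ suc (countB S)
expWeight-oneClass S = begin
  suc (classSize S (λ _ → zero) zero) * prodF (λ c → suc (classSize S (λ _ → zero) (suc c)))
    ≤⟨ *-mono-≤ (s≤s (countB-mono {g = S} inClass))
                (prodF-≤1 {f = λ c → suc (classSize S (λ _ → zero) (suc c))}
                          λ c → s≤s (≤-reflexive (countB-none empty))) ⟩
  suc (countB S) * 1
    ≡⟨ *-identityʳ _ ⟩
  suc (countB S) ∎
  where
  open ≤-Reasoning
  inClass : ∀ v → (if S v then true else false) ≡ true → S v ≡ true
  inClass v e with S v
  ... | true = refl
  empty : ∀ v → (if S v then false else false) ≡ false
  empty v with S v
  ... | true  = refl
  ... | false = refl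

comparability : (T : Tree) → Graph (suc (k T))
comparability T = record
  { adj    = λ u v → does (distinct-comparable? u v)
  ; sym    = λ u v → does-⇔ (mk⇔ flip flip) (distinct-comparable? u v) (distinct-comparable? v u)
  ; irrefl = λ v → dec-false (distinct-comparable? v v) λ (v≢v , _) → v≢v refl
  }
  where
  flip : ∀ {u v} → u ≢ v × Comparable T u v → v ≢ u × Comparable T v u
  flip (u≢v , u~v) = u≢v ∘ ≡.sym , Sum.swap u~v

module _ {T : Tree} where

  adjacent⇒comparable : ∀ {u v} → adj (comparability T) u v ≡ true → Comparable T u v
  adjacent⇒comparable {u} {v} e = proj₂ (from-does (distinct-comparable? u v) e)

  comparable⇒adjacent : ∀ {u v} → u ≢ v → Comparable T u v → adj (comparability T) u v ≡ true
  comparable⇒adjacent {u} {v} u≢v u~v = dec-true (distinct-comparable? u v) (u≢v , u~v)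

  rainbow⇒clique : ∀ {P : Node T → Node T} {L} → AllPairs (λ a b → Ancestor T a b × P a ≢ P b) L →
                   AllPairs (λ a b → adj (comparability T) a b ≡ true) L
  rainbow⇒clique {P} = AllPairs.map λ (a≼b , Pa≢Pb) → comparable⇒adjacent (Pa≢Pb ∘ cong P) (inj₁ a≼b)

  same-class⇒comparable : ∀ {P} → GlobalCliquePartition (comparability T) P →
                          ∀ {u v} → P u ≡ P v → Comparable T u v
  same-class⇒comparable partition {u} {v} Pu≡Pv with u ≟ v
  ... | yes refl = inj₁ self
  ... | no u≢v   = adjacent⇒comparable (partition u v refl refl Pu≡Pv u≢v)

module _ (T : Tree) where

  ancestorBag : Node T → Node T → Bool
  ancestorBag t v = does (ancestor? {T} v t)

  #ancestors : Node T → ℕ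
  #ancestors t = countB (ancestorBag t)

  private
    ∈ancestorBag : ∀ {v t} → Ancestor T v t → ancestorBag t v ≡ true
    ∈ancestorBag {v} {t} = dec-true (ancestor? {T} v t)

    ancestorBag⇒ancestor : ∀ {v t} → ancestorBag t v ≡ true → Ancestor T v t
    ancestorBag⇒ancestor {v} {t} = from-does (ancestor? {T} v t)

    walk-up : ∀ {v t} → Ancestor T v t → WalkIn T (λ s → ancestorBag s v) t v
    walk-up {v} self     = here (∈ancestorBag {v} self)
    walk-up (parent j p) = step (∈ancestorBag (parent j p)) (up j) (walk-up p)

    walk-down : ∀ {v t} → Ancestor T v t → WalkIn T (λ s → ancestorBag s v) v t
    walk-down {v} self     = here (∈ancestorBag {v} self)
    walk-down (parent j p) =
      walk-down p ++ʷ step (∈ancestorBag p) (down j) (here (∈ancestorBag (parent j p)))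

    lower-bag : ∀ u v → adj (comparability T) u v ≡ true →
                ∃ λ t → ancestorBag t u ≡ true × ancestorBag t v ≡ true
    lower-bag u v e with adjacent⇒comparable {T} {u} {v} e
    ... | inj₁ u≼v = v , ∈ancestorBag u≼v , ∈ancestorBag {v} self
    ... | inj₂ v≼u = u , ∈ancestorBag {u} self , ∈ancestorBag v≼u

  pathDecomposition : CPTreeDec (comparability T)
  pathDecomposition = record
    { dec  = record
      { tree  = T
      ; bag   = ancestorBag
      ; cover = λ v → v , ∈ancestorBag {v} self
      ; edges = lower-bag
      ; conn  = λ v t t′ vt vt′ →
          walk-up (ancestorBag⇒ancestor {v} {t} vt) ++ʷ walk-down (ancestorBag⇒ancestor {v} {t′} vt′)
      }
    ; lab  = λ _ _ → zero
    ; cliq = λ t u v ut vt _ u≢v →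
        comparable⇒adjacent {T} u≢v
          (ancestors-comparable (ancestorBag⇒ancestor {u} {t} ut) (ancestorBag⇒ancestor {v} {t} vt))
    }

  #ancestors-root : #ancestors zero ≤ 1
  #ancestors-root =
    ≤-trans (countB-≤-suc zero only-root)
            (s≤s (≤-reflexive (countB-none {suc (k T)} {λ _ → false} λ _ → refl)))
    where
    only-root : ∀ v → ancestorBag zero v ≡ true → false ≡ true ⊎ v ≡ zero
    only-root v e with ancestorBag⇒ancestor {v} e
    ... | self = inj₂ refl

  #ancestors-child : ∀ j → #ancestors (suc j) ≤ suc (#ancestors (par T j))
  #ancestors-child j = countB-≤-suc (suc j) via-parent
    where
    via-parent : ∀ v → ancestorBag (suc j) v ≡ true → ancestorBag (par T j) v ≡ true ⊎ v ≡ suc j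
    via-parent v e with ancestorBag⇒ancestor {v} e
    ... | self        = inj₂ refl
    ... | parent .j p = inj₁ (∈ancestorBag p)

data Perfect (T : Tree) : ℕ → Node T → Set where
  leaf : ∀ {x} → Perfect T 0 x
  node : ∀ {h x} i j → par T i ≡ x → par T j ≡ x → i ≢ j →
         Perfect T h (suc i) → Perfect T h (suc j) → Perfect T (suc h) x

module _ {T : Tree} {P : Node T → Node T} (partition : GlobalCliquePartition (comparability T) P) where

  RainbowChain : Node T → ℕ → Set
  RainbowChain x h = Σ (List (Node T)) λ L →
    length L ≡ h × AllPairs (λ a b → Ancestor T a b × P a ≢ P b) (x ∷ L)

  class-within-one-branch : ∀ {i j v w} → par T i ≡ par T j → i ≢ j →
                            Ancestor T (suc i) v → Ancestor T (suc j) w → P v ≢ P w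
  class-within-one-branch pi≡pj i≢j i≼v j≼w Pv≡Pw with same-class⇒comparable partition Pv≡Pw
  ... | inj₁ v≼w = siblings-disjoint pi≡pj i≢j (ancestor-trans i≼v v≼w) j≼w
  ... | inj₂ w≼v = siblings-disjoint pi≡pj i≢j i≼v (ancestor-trans j≼w w≼v)

  rainbow-extend : ∀ {x c h} → Ancestor T x c → (∀ v → Ancestor T c v → P v ≢ P x) →
                   RainbowChain c h → RainbowChain x (suc h)
  rainbow-extend {x} {c} x≼c avoids (L , len , chain@(c≺L ∷ _)) =
    c ∷ L , cong suc len , ((x≼c , differs self) ∷ All.map below c≺L) ∷ chain
    where
    differs : ∀ {v} → Ancestor T c v → P x ≢ P v
    differs c≼v = avoids _ c≼v ∘ ≡.sym
    below : ∀ {v} → Ancestor T c v × P c ≢ P v → Ancestor T x v × P x ≢ P v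
    below (c≼v , _) = ancestor-trans x≼c c≼v , differs c≼v

  -- The class of x reaches below at most one child of x; descend into a child it avoids.
  rainbow-chain : ∀ {h x} → Perfect T h x → RainbowChain x h
  rainbow-chain leaf = [] , refl , [] ∷ []
  rainbow-chain {x = x} (node i j pi pj i≢j perfect-i perfect-j)
    with any? (λ v → ancestor? (suc i) v ×-dec (P v ≟ P x))
  ... | no class∌below-i =
    rainbow-extend (parent⇒ancestor pi) (λ v i≼v Pv≡Px → class∌below-i (v , i≼v , Pv≡Px))
      (rainbow-chain perfect-i)
  ... | yes (v , i≼v , Pv≡Px) =
    rainbow-extend (parent⇒ancestor pj)
      (λ w j≼w Pw≡Px → class-within-one-branch (≡.trans pi (≡.sym pj)) i≢j i≼v j≼w
                         (≡.trans Pv≡Px (≡.sym Pw≡Px)))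
      (rainbow-chain perfect-j)

perfect⇒bbkmz : ∀ {T h x} → Perfect T h x → BBKMZAtLeast (comparability T) 1 (2 ^ suc h)
perfect⇒bbkmz {h = h} {x} perfect P partition D =
  let L , len , chain = rainbow-chain partition perfect
      t , chain⊆t     = clique⊆bag D x L (rainbow⇒clique chain)
  in t , (begin
    2 ^ suc h                 ≡⟨ cong (λ l → 2 ^ suc l) len ⟨
    2 ^ length (x ∷ L)
      ≤⟨ 2^length≤expWeight (bag D t) P (x ∷ L) chain⊆t (AllPairs.map proj₂ chain) ⟩
    expWeight (bag D t) P     ≡⟨ *-identityʳ _ ⟨
    expWeight (bag D t) P ^ 1 ∎)
  where open ≤-Reasoning

-- Node j + 1 has parent ⌊j/2⌋: node x has children 2x + 1 and 2x + 2, and depth ⌊log₂ (x + 1)⌋.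
heap : ℕ → Tree
heap k = record
  { k    = k
  ; par  = λ j → fromℕ< (half<1+k j)
  ; par< = λ j → ≤-trans (≤-reflexive (toℕ-fromℕ< (half<1+k j))) (⌊n/2⌋≤n (toℕ j))
  }
  where
  half<1+k : (j : Fin k) → ⌊ toℕ j /2⌋ < suc k
  half<1+k j = s≤s (≤-trans (⌊n/2⌋≤n (toℕ j)) (<⇒≤ (toℕ<n j)))

toℕ-par-heap : ∀ {k} (j : Fin k) → toℕ (par (heap k) j) ≡ ⌊ toℕ j /2⌋
toℕ-par-heap j = toℕ-fromℕ< _

-- The bound says that the rightmost depth-h descendant of x, node (x + 2)·2^h − 2, exists.
heap-perfect : ∀ {k} h (x : Fin (suc k)) → (2 + toℕ x) * 2 ^ h ≤ 2 + k → Perfect (heap k) h x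
heap-perfect         zero    x _    = leaf
heap-perfect {k = k} (suc h) x room =
  node i j (parent-is i (≡.trans (cong ⌊_/2⌋ toℕ-i) (≡.sym (n≡⌊n+n/2⌋ n))))
           (parent-is j (≡.trans (cong ⌊_/2⌋ toℕ-j) (≡.sym (n≡⌈n+n/2⌉ n))))
           i≢j
           (heap-perfect h (suc i) (fits (suc i) (s≤s (≤-trans (≤-reflexive toℕ-i) (n≤1+n _)))))
           (heap-perfect h (suc j) (fits (suc j) (s≤s (≤-reflexive toℕ-j))))
  where
  n : ℕ
  n = toℕ x

  children-room : ∀ n y → (2 + n) * (2 * y) ≡ (2 + suc (suc (n + n))) * y
  children-room = solve-∀

  room′ : (2 + suc (suc (n + n))) * 2 ^ h ≤ 2 + k
  room′ = ≤-trans (≤-reflexive (≡.sym (children-room n (2 ^ h)))) room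

  2+2n≤k : suc (suc (n + n)) ≤ k
  2+2n≤k = s≤s⁻¹ (s≤s⁻¹ (≤-trans (m≤m*n _ (2 ^ h) {{m^n≢0 2 h}}) room′))

  i j : Fin k
  i = fromℕ< {n + n} (≤-trans (n≤1+n _) 2+2n≤k)
  j = fromℕ< {suc (n + n)} 2+2n≤k

  toℕ-i : toℕ i ≡ n + n
  toℕ-i = toℕ-fromℕ< _

  toℕ-j : toℕ j ≡ suc (n + n)
  toℕ-j = toℕ-fromℕ< _

  i≢j : i ≢ j
  i≢j i≡j = 1+n≰n (≤-reflexive (≡.trans (≡.sym toℕ-j) (≡.trans (cong toℕ (≡.sym i≡j)) toℕ-i)))

  parent-is : ∀ c → ⌊ toℕ c /2⌋ ≡ n → par (heap k) c ≡ x
  parent-is c half≡n = toℕ-injective (≡.trans (toℕ-par-heap c) half≡n)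

  fits : ∀ c → toℕ c ≤ suc (suc (n + n)) → (2 + toℕ c) * 2 ^ h ≤ 2 + k
  fits c c≤ = ≤-trans (*-monoˡ-≤ (2 ^ h) (+-monoʳ-≤ 2 c≤)) room′

⌊n/2⌋<m : ∀ {n m} → n < 2 * m → ⌊ n /2⌋ < m
⌊n/2⌋<m {n} {m} n<2m = *-cancelˡ-< 2 _ _ (≤-<-trans twice-half≤n n<2m)
  where
  open ≤-Reasoning
  twice-half≤n : 2 * ⌊ n /2⌋ ≤ n
  twice-half≤n = begin
    2 * ⌊ n /2⌋           ≡⟨ cong (⌊ n /2⌋ +_) (+-identityʳ _) ⟩
    ⌊ n /2⌋ + ⌊ n /2⌋     ≤⟨ +-monoʳ-≤ ⌊ n /2⌋ (⌊n/2⌋≤⌈n/2⌉ n) ⟩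
    ⌊ n /2⌋ + ⌈ n /2⌉     ≡⟨ ⌊n/2⌋+⌈n/2⌉≡n n ⟩
    n                     ∎

-- suc (toℕ t) < 2 ^ suc d says that t has depth at most d.
heap-#ancestors : ∀ {k} d (t : Fin (suc k)) → suc (toℕ t) < 2 ^ suc d → #ancestors (heap k) t ≤ suc d
heap-#ancestors {k} d zero    _              = ≤-trans (#ancestors-root (heap k)) (s≤s z≤n)
heap-#ancestors zero    (suc j) (s≤s (s≤s ()))
heap-#ancestors (suc d) (suc j) t<2^d =
  ≤-trans (#ancestors-child (heap _) j) (s≤s (heap-#ancestors d (par (heap _) j) parent<2^d))
  where
  parent<2^d : suc (toℕ (par (heap _) j)) < 2 ^ suc d
  parent<2^d rewrite toℕ-par-heap j = ⌊n/2⌋<m t<2^d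

lastNode : ℕ → ℕ
lastNode zero    = 3
lastNode (suc i) = suc (lastNode i + lastNode i)

suc-lastNode : ∀ i → suc (lastNode i) ≡ 2 ^ (2 + i)
suc-lastNode zero    = refl
suc-lastNode (suc i) = ≡.trans (doubling (lastNode i)) (cong (2 *_) (suc-lastNode i))
  where
  doubling : ∀ a → suc (suc (a + a)) ≡ 2 * suc a
  doubling = solve-∀

heapGraph : (i : ℕ) → Graph (suc (lastNode i))
heapGraph i = comparability (heap (lastNode i))

heapGraph-cptw : ∀ i → CPTWExpAtMost (heapGraph i) (⌊log₂ suc (lastNode i) ⌋ ^ 2)
heapGraph-cptw i = pathDecomposition T , bag-weight
  where
  T : Tree
  T = heap (lastNode i)

  log≡ : ⌊log₂ suc (lastNode i) ⌋ ≡ 2 + i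
  log≡ = ≡.trans (cong ⌊log₂_⌋ (suc-lastNode i)) (⌊log₂[2^n]⌋≡n (2 + i))

  shallow : ∀ t → suc (toℕ t) < 2 ^ suc (2 + i)
  shallow t = ≤-<-trans (≤-trans (toℕ<n t) (≤-reflexive (suc-lastNode i)))
                        (^-monoʳ-< 2 (s≤s (s≤s z≤n)) (n<1+n (2 + i)))

  square : ∀ i → (2 + i) * ((2 + i) * 1) ≡ (4 + i) + (3 * i + i * i)
  square = solve-∀

  bag-weight : ∀ t → expWeight (ancestorBag T t) (λ _ → zero) ≤ ⌊log₂ suc (lastNode i) ⌋ ^ 2
  bag-weight t = begin
    expWeight (ancestorBag T t) (λ _ → zero) ≤⟨ expWeight-oneClass (ancestorBag T t) ⟩
    suc (#ancestors T t)                     ≤⟨ s≤s (heap-#ancestors (2 + i) t (shallow t)) ⟩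
    4 + i                                    ≤⟨ m≤m+n (4 + i) _ ⟩
    (4 + i) + (3 * i + i * i)                ≡⟨ square i ⟨
    (2 + i) ^ 2                              ≡⟨ cong (_^ 2) log≡ ⟨
    ⌊log₂ suc (lastNode i) ⌋ ^ 2             ∎
    where open ≤-Reasoning

heap-root-perfect : ∀ i → Perfect (heap (lastNode i)) (suc i) zero
heap-root-perfect i =
  heap-perfect (suc i) zero (≤-trans (≤-reflexive (≡.sym (suc-lastNode i))) (n≤1+n _))

heapGraph-bbkmz : ∀ i → BBKMZAtLeast (heapGraph i) 1 (suc (lastNode i))
heapGraph-bbkmz i =
  subst (BBKMZAtLeast (heapGraph i) 1) (≡.sym (suc-lastNode i)) (perfect⇒bbkmz (heap-root-perfect i))

lemma1 : Σ (ℕ → ℕ) λ size → Σ ((i : ℕ) → Graph (size i)) λ F →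
    (∀ i → size i < size (suc i)) ×
    Σ ℕ λ c → Σ ℕ λ d → (1 ≤ d) × Σ ℕ λ N →
      (∀ i → N ≤ size i →
        CPTWExpAtMost (F i) (⌊log₂ size i ⌋ ^ c) ×
        BBKMZAtLeast (F i) d (size i))
lemma1 =
  (λ i → suc (lastNode i)) , heapGraph , (λ i → s≤s (s≤s (m≤m+n _ _))) ,
  2 , 1 , s≤s z≤n , 0 , λ i _ → heapGraph-cptw i , heapGraph-bbkmz i
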